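{- Let $T_1$ and $T_2$ be trees with $\gamma_P(T_1) = \gamma(T_1)$ and $\gamma_P(T_2) = \gamma(T_2)$. Then $\gamma_P(T_1 \Box T_2) \ge \gamma_P(T_1)\gamma_P(T_2)$.
   Context: Graphs are finite and simple. $\gamma(G)$ denotes the domination number of $G$ (minimum size of a set $D$ with $N[D]=V(G)$). For $S \subseteq V(G)$, vertices are observed as follows: initially every vertex of $S$ and every neighbor of a vertex of $S$ is observed; then, repeatedly, whenever an observed vertex has exactly one unobserved neighbor, that neighbor becomes observed. $S$ is a power dominating set if eventually all vertices are observed; $\gamma_P(G)$ is the minimum size of a power dominating set. The Cartesian product $G \Box H$ has vertex set $V(G)\times V(H)$, with $(g_1,h_1)$ adjacent to $(g_2,h_2)$ iff either $g_1=g_2$ and $h_1h_2 \in E(H)$, or $h_1=h_2$ and $g_1g_2\in E(G)$. -}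

module Defs where

open import Data.Nat using (ℕ; _*_; _≤_; _∸_; suc)
open import Data.Bool using (Bool; true; false; _∨_; _∧_)
open import Data.Fin using (Fin; remQuot; _≟_)
open import Data.Fin.Subset using (Subset; _∈_; ∣_∣)
import Data.Empty
open import Data.Sum using (_⊎_)
open import Data.Product using (_×_; _,_; ∃; ∃-syntax; proj₁; proj₂)
open import Data.List using (List; []; _∷_; length; _++_)
open import Data.List.Relation.Unary.AllPairs using (AllPairs)
open import Relation.Binary.PropositionalEquality using (_≡_; _≢_; refl; cong₂) renaming (sym to ≡-sym)
open import Relation.Nullary using (¬_; does; yes; no)

record Graph : Set where
  field
    n     : ℕ
    adj   : Fin n → Fin n → Bool
    adj-sym : ∀ u v → adj u v ≡ adj v u
    irrefl : ∀ u → adj u u ≡ false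

open Graph public

V : Graph → Set
V G = Fin (n G)

Adj : (G : Graph) → V G → V G → Set
Adj G u v = adj G u v ≡ true

data Walk (G : Graph) : V G → V G → Set where
  here : ∀ {u} → Walk G u u
  step : ∀ {u v w} → Adj G u v → Walk G v w → Walk G u w

Connected : Graph → Set
Connected G = ∀ (u v : V G) → Walk G u v

data AdjChain (G : Graph) : List (V G) → Set where
  one  : ∀ {u} → AdjChain G (u ∷ [])
  cons : ∀ {u v vs} → Adj G u v → AdjChain G (v ∷ vs) → AdjChain G (u ∷ v ∷ vs)

record Cycle (G : Graph) : Set where
  field
    first    : V G
    rest     : List (V G)
    last     : V G
    long     : 2 ≤ suc (length rest)
    chain    : AdjChain G (first ∷ rest ++ (last ∷ []))
    distinct : AllPairs _≢_ (first ∷ rest ++ (last ∷ []))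
    closing  : Adj G last first

Acyclic : Graph → Set
Acyclic G = ¬ Cycle G

IsTree : Graph → Set
IsTree G = (1 ≤ n G) × Connected G × Acyclic G

-- Cartesian product G □ H on Fin (n G * n H), vertex x ↔ remQuot x = (g , h)
adjPair : (G H : Graph) → V G × V H → V G × V H → Bool
adjPair G H p q =
  (does (proj₁ p ≟ proj₁ q) ∧ adj H (proj₂ p) (proj₂ q))
  ∨ (does (proj₂ p ≟ proj₂ q) ∧ adj G (proj₁ p) (proj₁ q))

adj□ : (G H : Graph) → Fin (n G * n H) → Fin (n G * n H) → Bool
adj□ G H x y = adjPair G H (remQuot (n H) x) (remQuot (n H) y)

private
  does-sym : ∀ {k} (a b : Fin k) → does (a ≟ b) ≡ does (b ≟ a)
  does-sym a b with a ≟ b | b ≟ a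
  ... | yes _ | yes _ = refl
  ... | no _  | no _  = refl
  ... | yes p | no q  = Data.Empty.⊥-elim (q (≡-sym p))
  ... | no p  | yes q = Data.Empty.⊥-elim (p (≡-sym q))

  does-refl : ∀ {k} (a : Fin k) → does (a ≟ a) ≡ true
  does-refl a with a ≟ a
  ... | yes _ = refl
  ... | no p  = Data.Empty.⊥-elim (p refl)

  adjPair-sym : (G H : Graph) → ∀ p q → adjPair G H p q ≡ adjPair G H q p
  adjPair-sym G H (g₁ , h₁) (g₂ , h₂) =
    cong₂ _∨_ (cong₂ _∧_ (does-sym g₁ g₂) (Graph.adj-sym H h₁ h₂))
              (cong₂ _∧_ (does-sym h₁ h₂) (Graph.adj-sym G g₁ g₂))

  adjPair-irrefl : (G H : Graph) → ∀ p → adjPair G H p p ≡ false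
  adjPair-irrefl G H (g , h) rewrite does-refl g | does-refl h | irrefl H h | irrefl G g = refl

  adj□-sym : (G H : Graph) → ∀ x y → adj□ G H x y ≡ adj□ G H y x
  adj□-sym G H x y = adjPair-sym G H (remQuot (n H) x) (remQuot (n H) y)

  adj□-irrefl : (G H : Graph) → ∀ x → adj□ G H x x ≡ false
  adj□-irrefl G H x = adjPair-irrefl G H (remQuot (n H) x)

_□_ : Graph → Graph → Graph
G □ H = record
  { n = n G * n H
  ; adj = adj□ G H
  ; adj-sym = adj□-sym G H
  ; irrefl = adj□-irrefl G H
  }

Dominating : (G : Graph) → Subset (n G) → Set
Dominating G S = ∀ v → v ∈ S ⊎ ∃[ u ] (u ∈ S × Adj G u v)

IsDominationNumber : Graph → ℕ → Set
IsDominationNumber G k =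
  (∃[ S ] (Dominating G S × ∣ S ∣ ≡ k)) × (∀ S → Dominating G S → k ≤ ∣ S ∣)

data Observed (G : Graph) (S : Subset (n G)) : V G → Set where
  inS   : ∀ {v} → v ∈ S → Observed G S v
  nbrS  : ∀ {u v} → u ∈ S → Adj G u v → Observed G S v
  force : ∀ {u v} → Observed G S u → Adj G u v
        → (∀ w → Adj G u w → w ≢ v → Observed G S w)
        → Observed G S v

PowerDominating : (G : Graph) → Subset (n G) → Set
PowerDominating G S = ∀ v → Observed G S v

IsPowerDominationNumber : Graph → ℕ → Set
IsPowerDominationNumber G k =
  (∃[ S ] (PowerDominating G S × ∣ S ∣ ≡ k)) × (∀ S → PowerDominating G S → k ≤ ∣ S ∣)

-- A fort of a graph is a nonempty vertex set F such that no vertex outside F has exactly one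
-- neighbour in F. Observation never enters a fort from outside, so every power dominating set
-- meets the closed neighbourhood N[F] of every fort. If F₁, F₂ are forts of G, H then F₁ × F₂ is
-- a fort of G □ H with N[F₁ × F₂] ⊆ N[F₁] × N[F₂]; hence k forts of G and l forts of H with
-- pairwise disjoint closed neighbourhoods give k l disjoint sets that every power dominating set
-- of G □ H must meet. In a tree T with a dominating set D of size γ_P(T), removing d ∈ D leaves a
-- nonempty set F_d of unobserved vertices; it is a fort, it lies in N[d] because D dominates, and
-- acyclicity forces N[F_d] ⊆ {d} ∪ F_d. These sets are pairwise disjoint, so T has |D| such forts.
--
-- Observation is an inductively generated predicate with no decision procedure at hand, so the
-- classical steps run in the double-negation monad; the final inequality is decidable.

module Submission where

open import Defs
open import Data.Nat using (ℕ; zero; suc; _*_; _≤_; _≤?_; z≤n; s≤s; _+_)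
open import Data.Nat.Properties using (≤-trans; <⇒≱)
open import Data.Bool using (true; false; _∧_; _∨_)
open import Data.Bool.Properties using (∨-zeroʳ)
open import Data.Fin using (Fin; zero; suc; _≟_; combine; remQuot)
open import Data.Fin.Properties using (remQuot-combine; suc-injective)
open import Data.Fin.Subset using (Subset; _∈_; _-_; ∣_∣; inside; outside)
open import Data.Fin.Subset.Properties using (x∈p∧x≢y⇒x∈p-y; x∈p⇒∣p-x∣<∣p∣)
open import Data.Vec using ([]; _∷_)
import Data.Vec as Vec
open import Data.List using (List; []; _∷_; length; map; cartesianProduct)
open import Data.List.Properties using (length-map; length-++)
open import Data.List.Membership.Propositional using () renaming (_∈_ to _∈ˡ_)
open import Data.List.Membership.Propositional.Properties using (∈-map⁻; ∈-cartesianProduct⁻)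
import Data.List.Relation.Unary.All as All
import Data.List.Relation.Unary.All.Properties as All
open import Data.List.Relation.Unary.Any using (here; there)
open import Data.List.Relation.Unary.AllPairs using ([]; _∷_)
open import Data.List.Relation.Unary.Unique.Propositional using (Unique)
open import Data.List.Relation.Unary.Unique.Propositional.Properties using (map⁺; cartesianProduct⁺)
open import Data.Product using (∃; _×_; _,_; proj₁; proj₂)
import Data.Sum as Sum
open import Data.Sum using (_⊎_; inj₁; inj₂)
open import Data.Unit using (⊤; tt)
open import Data.Empty using (⊥; ⊥-elim)
open import Effect.Monad using (RawMonad)
open import Function using (_∘_)
open import Level using (0ℓ)
open import Relation.Binary.PropositionalEquality using (_≡_; _≢_; refl; sym; trans; cong; cong₂; subst)
open import Relation.Nullary.Decidable using (Dec; yes; no; does; decidable-stable; dec-true)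
open import Relation.Nullary.Negation using (¬_; ¬¬-Monad)

open RawMonad (¬¬-Monad {0ℓ})

¬¬-pull : ∀ {n} {P : Fin n → Set} → (∀ i → ¬ ¬ P i) → ¬ ¬ (∀ i → P i)
¬¬-pull {zero}  _   = pure λ ()
¬¬-pull {suc n} ¬¬P = do
  p₀ ← ¬¬P zero
  ps ← ¬¬-pull (¬¬P ∘ suc)
  pure λ { zero → p₀ ; (suc i) → ps i }

¬∀⟶¬¬∃¬ : ∀ {n} {P Q : Fin n → Set} → ¬ (∀ i → P i → Q i) → ¬ ¬ ∃ λ i → P i × ¬ Q i
¬∀⟶¬¬∃¬ ¬∀ ¬∃ = ¬¬-pull (λ i ¬[P→Q] → ¬[P→Q] λ p → ⊥-elim (¬∃ (i , p , λ q → ¬[P→Q] λ _ → q))) ¬∀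

Near : (G : Graph) → V G → V G → Set
Near G u v = v ≡ u ⊎ Adj G u v

Adj-sym : ∀ G {u v} → Adj G u v → Adj G v u
Adj-sym G {u} {v} u~v = trans (adj-sym G v u) u~v

Adj⇒≢ : ∀ G {u v} → Adj G u v → u ≢ v
Adj⇒≢ G {u} u~u refl with trans (sym u~u) (irrefl G u)
... | ()

near-observed : ∀ {G S u v} → u ∈ S → Near G u v → Observed G S v
near-observed u∈S (inj₁ refl) = inS u∈S
near-observed u∈S (inj₂ u~v)  = nbrS u∈S u~v

module _ (G : Graph) where

  ClosedNbhd : (V G → Set) → V G → Set
  ClosedNbhd F v = F v ⊎ ∃ λ u → F u × Adj G v u

  record Fort (F : V G → Set) : Set where
    field
      nonempty : ¬ ¬ ∃ F
      closed   : ∀ {x y} → F x → Adj G y x → ¬ F y → ¬ ¬ ∃ λ w → F w × w ≢ x × Adj G y w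

  fort-meets-closedNbhd : ∀ {S F} → PowerDominating G S → Fort F → ¬ ¬ ∃ λ v → v ∈ S × ClosedNbhd F v
  fort-meets-closedNbhd {S} {F} pd fort misses = nonempty λ (x , Fx) → observed⇒¬F (pd x) Fx
    where
    open Fort fort
    observed⇒¬F : ∀ {v} → Observed G S v → ¬ F v
    observed⇒¬F (inS v∈S)         Fv = misses (_ , v∈S , inj₁ Fv)
    observed⇒¬F (nbrS u∈S u~v)    Fv = misses (_ , u∈S , inj₂ (_ , Fv , u~v))
    observed⇒¬F (force obs u~v others) Fv =
      closed Fv u~v (observed⇒¬F obs) λ (w , Fw , w≢v , u~w) → observed⇒¬F (others w u~w w≢v) Fw

  unobserved-closed : ∀ {S x y} → ¬ Observed G S x → Adj G y x → ¬ ¬ Observed G S y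
                    → ¬ ¬ ∃ λ w → ¬ Observed G S w × w ≢ x × Adj G y w
  unobserved-closed {S} {x} {y} ¬obs-x y~x ¬¬obs-y = do
    obs-y ← ¬¬obs-y
    (w , (y~w , w≢x) , ¬obs-w) ← ¬∀⟶¬¬∃¬ {P = λ w → Adj G y w × w ≢ x} {Q = Observed G S}
      λ others → ¬obs-x (force obs-y y~x λ w y~w w≢x → others w (y~w , w≢x))
    pure (w , ¬obs-w , w≢x , y~w)

  unobserved-fort : ∀ {S} → ¬ PowerDominating G S → Fort (λ v → ¬ Observed G S v)
  unobserved-fort {S} ¬pd = record { nonempty = nonempty ; closed = unobserved-closed }
    where
    nonempty : ¬ ¬ ∃ λ v → ¬ Observed G S v
    nonempty = do
      (v , _ , ¬obs) ← ¬∀⟶¬¬∃¬ {P = λ _ → ⊤} (λ all → ¬pd λ v → all v tt)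
      pure (v , ¬obs)

record FortPacking (G : Graph) (k : ℕ) : Set₁ where
  field
    Index    : Set
    indices  : List Index
    unique   : Unique indices
    size     : length indices ≡ k
    fort     : Index → V G → Set
    isFort   : ∀ {i} → i ∈ˡ indices → Fort G (fort i)
    disjoint : ∀ {i j v} → i ∈ˡ indices → j ∈ˡ indices
             → ClosedNbhd G (fort i) v → ClosedNbhd G (fort j) v → i ≡ j

disjoint-hitting⇒≤ : ∀ {A : Set} {N} (B : A → Fin N → Set) {K : List A} (S : Subset N) → Unique K
  → (∀ {k} → k ∈ˡ K → ¬ ¬ ∃ λ x → x ∈ S × B k x)
  → (∀ {k k' x} → k ∈ˡ K → k' ∈ˡ K → B k x → B k' x → k ≡ k')
  → ¬ ¬ (length K ≤ ∣ S ∣)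
disjoint-hitting⇒≤ B {[]}    S _              _    _        = pure z≤n
disjoint-hitting⇒≤ B {k ∷ K} S (k∉K ∷ unique) hits disjoint = do
  (x , x∈S , Bkx) ← hits (here refl)
  |K|≤ ← disjoint-hitting⇒≤ B (S - x) unique (hits-S-x x Bkx)
           (λ k∈ k'∈ → disjoint (there k∈) (there k'∈))
  pure (≤-trans (s≤s |K|≤) (x∈p⇒∣p-x∣<∣p∣ x∈S))
  where
  hits-S-x : ∀ x → B k x → ∀ {k'} → k' ∈ˡ K → ¬ ¬ ∃ λ y → y ∈ S - x × B k' y
  hits-S-x x Bkx k'∈K = do
    (y , y∈S , Bk'y) ← hits (there k'∈K)
    let y≢x = λ { refl → All.lookup k∉K k'∈K (disjoint (here refl) (there k'∈K) Bkx Bk'y) }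
    pure (y , x∈p∧x≢y⇒x∈p-y y∈S y≢x , Bk'y)

fortPacking⇒≤ : ∀ {G k S} → FortPacking G k → PowerDominating G S → k ≤ ∣ S ∣
fortPacking⇒≤ {G} {k} {S} packing pd = decidable-stable (k ≤? ∣ S ∣)
  (subst (_≤ ∣ S ∣) size <$> disjoint-hitting⇒≤ (ClosedNbhd G ∘ fort) S unique
    (λ i∈ → fort-meets-closedNbhd G pd (isFort i∈)) disjoint)
  where open FortPacking packing

length-cartesianProduct : ∀ {A B : Set} (xs : List A) (ys : List B)
                        → length (cartesianProduct xs ys) ≡ length xs * length ys
length-cartesianProduct []       ys = refl
length-cartesianProduct (x ∷ xs) ys =
  trans (length-++ (map (x ,_) ys)) (cong₂ _+_ (length-map (x ,_) ys) (length-cartesianProduct xs ys))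

∨-≡-true : ∀ {a b} → a ∨ b ≡ true → a ≡ true ⊎ b ≡ true
∨-≡-true {true}  _ = inj₁ refl
∨-≡-true {false} b = inj₂ b

does-∧-≡-true : ∀ {A : Set} (a? : Dec A) {b} → does a? ∧ b ≡ true → A × b ≡ true
does-∧-≡-true (yes a) b = a , b
does-∧-≡-true (no _)  ()

module Product (G H : Graph) where

  fst : V (G □ H) → V G
  fst z = proj₁ (remQuot {n G} (n H) z)

  snd : V (G □ H) → V H
  snd z = proj₂ (remQuot {n G} (n H) z)

  _,□_ : V G → V H → V (G □ H)
  g ,□ h = combine g h

  fst-,□ : ∀ g h → fst (g ,□ h) ≡ g
  fst-,□ g h = cong proj₁ (remQuot-combine g h)

  snd-,□ : ∀ g h → snd (g ,□ h) ≡ h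
  snd-,□ g h = cong proj₂ (remQuot-combine g h)

  Adj□⇒ : ∀ {z z'} → Adj (G □ H) z z' →
          (fst z ≡ fst z' × Adj H (snd z) (snd z')) ⊎ (snd z ≡ snd z' × Adj G (fst z) (fst z'))
  Adj□⇒ {z} {z'} z~z' =
    Sum.map (does-∧-≡-true (fst z ≟ fst z')) (does-∧-≡-true (snd z ≟ snd z')) (∨-≡-true z~z')

  adjPair-sameˡ : ∀ g {h h'} → Adj H h h' → adjPair G H (g , h) (g , h') ≡ true
  adjPair-sameˡ g h~h' rewrite dec-true (g ≟ g) refl | h~h' = refl

  adjPair-sameʳ : ∀ {g g'} h → Adj G g g' → adjPair G H (g , h) (g' , h) ≡ true
  adjPair-sameʳ h g~g' rewrite dec-true (h ≟ h) refl | g~g' = ∨-zeroʳ _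

  Adj□ʳ : ∀ {z h} → Adj H (snd z) h → Adj (G □ H) z (fst z ,□ h)
  Adj□ʳ {z} {h} sz~h = subst (λ q → adjPair G H (remQuot (n H) z) q ≡ true)
    (sym (remQuot-combine (fst z) h)) (adjPair-sameˡ (fst z) sz~h)

  Adj□ˡ : ∀ {z g} → Adj G (fst z) g → Adj (G □ H) z (g ,□ snd z)
  Adj□ˡ {z} {g} fz~g = subst (λ q → adjPair G H (remQuot (n H) z) q ≡ true)
    (sym (remQuot-combine g (snd z))) (adjPair-sameʳ (snd z) fz~g)

  _⊠_ : (V G → Set) → (V H → Set) → V (G □ H) → Set
  (F₁ ⊠ F₂) z = F₁ (fst z) × F₂ (snd z)

  closedNbhd-⊠ : ∀ {F₁ F₂ z} → ClosedNbhd (G □ H) (F₁ ⊠ F₂) z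
               → ClosedNbhd G F₁ (fst z) × ClosedNbhd H F₂ (snd z)
  closedNbhd-⊠ (inj₁ (F₁z , F₂z)) = inj₁ F₁z , inj₁ F₂z
  closedNbhd-⊠ {F₁} {F₂} (inj₂ (u , (F₁u , F₂u) , z~u)) with Adj□⇒ z~u
  ... | inj₁ (fz≡fu , sz~su) = inj₁ (subst F₁ (sym fz≡fu) F₁u) , inj₂ (snd u , F₂u , sz~su)
  ... | inj₂ (sz≡su , fz~fu) = inj₂ (fst u , F₁u , fz~fu) , inj₁ (subst F₂ (sym sz≡su) F₂u)

  fort-⊠ : ∀ {F₁ F₂} → Fort G F₁ → Fort H F₂ → Fort (G □ H) (F₁ ⊠ F₂)
  fort-⊠ {F₁} {F₂} fort₁ fort₂ = record { nonempty = nonempty ; closed = closed }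
    where
    module ₁ = Fort fort₁
    module ₂ = Fort fort₂

    nonempty : ¬ ¬ ∃ (F₁ ⊠ F₂)
    nonempty = do
      (g , F₁g) ← ₁.nonempty
      (h , F₂h) ← ₂.nonempty
      pure (g ,□ h , subst F₁ (sym (fst-,□ g h)) F₁g , subst F₂ (sym (snd-,□ g h)) F₂h)

    closed : ∀ {x y} → (F₁ ⊠ F₂) x → Adj (G □ H) y x → ¬ (F₁ ⊠ F₂) y
           → ¬ ¬ ∃ λ w → (F₁ ⊠ F₂) w × w ≢ x × Adj (G □ H) y w
    closed {x} {y} (F₁x , F₂x) y~x ¬Fy with Adj□⇒ y~x
    ... | inj₁ (fy≡fx , sy~sx) = do
      let F₁y = subst F₁ (sym fy≡fx) F₁x
      (h , F₂h , h≢sx , sy~h) ← ₂.closed F₂x sy~sx λ F₂y → ¬Fy (F₁y , F₂y)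
      pure ( fst y ,□ h
           , (subst F₁ (sym (fst-,□ (fst y) h)) F₁y , subst F₂ (sym (snd-,□ (fst y) h)) F₂h)
           , (λ w≡x → h≢sx (trans (sym (snd-,□ (fst y) h)) (cong snd w≡x)))
           , Adj□ʳ sy~h )
    ... | inj₂ (sy≡sx , fy~fx) = do
      let F₂y = subst F₂ (sym sy≡sx) F₂x
      (g , F₁g , g≢fx , fy~g) ← ₁.closed F₁x fy~fx λ F₁y → ¬Fy (F₁y , F₂y)
      pure ( g ,□ snd y
           , (subst F₁ (sym (fst-,□ g (snd y))) F₁g , subst F₂ (sym (snd-,□ g (snd y))) F₂y)
           , (λ w≡x → g≢fx (trans (sym (fst-,□ g (snd y))) (cong fst w≡x)))
           , Adj□ˡ fy~g )

  fortPacking-□ : ∀ {k l} → FortPacking G k → FortPacking H l → FortPacking (G □ H) (k * l)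
  fortPacking-□ P₁ P₂ = record
    { Index    = ₁.Index × ₂.Index
    ; indices  = cartesianProduct ₁.indices ₂.indices
    ; unique   = cartesianProduct⁺ ₁.unique ₂.unique
    ; size     = trans (length-cartesianProduct ₁.indices ₂.indices) (cong₂ _*_ ₁.size ₂.size)
    ; fort     = λ (i , j) → ₁.fort i ⊠ ₂.fort j
    ; isFort   = λ ij∈ → let (i∈ , j∈) = ∈-cartesianProduct⁻ ₁.indices ₂.indices ij∈
                         in fort-⊠ (₁.isFort i∈) (₂.isFort j∈)
    ; disjoint = λ ij∈ ij'∈ v∈N v∈N' →
        let (i∈ , j∈)   = ∈-cartesianProduct⁻ ₁.indices ₂.indices ij∈
            (i'∈ , j'∈) = ∈-cartesianProduct⁻ ₁.indices ₂.indices ij'∈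
            (v₁∈N , v₂∈N)   = closedNbhd-⊠ v∈N
            (v₁∈N' , v₂∈N') = closedNbhd-⊠ v∈N'
        in cong₂ _,_ (₁.disjoint i∈ i'∈ v₁∈N v₁∈N') (₂.disjoint j∈ j'∈ v₂∈N v₂∈N')
    }
    where
    module ₁ = FortPacking P₁
    module ₂ = FortPacking P₂

elements : ∀ {m} → Subset m → List (Fin m)
elements []            = []
elements (inside ∷ p)  = zero ∷ map suc (elements p)
elements (outside ∷ p) = map suc (elements p)

length-elements : ∀ {m} (p : Subset m) → length (elements p) ≡ ∣ p ∣
length-elements []            = refl
length-elements (inside ∷ p)  = cong suc (trans (length-map suc (elements p)) (length-elements p))
length-elements (outside ∷ p) = trans (length-map suc (elements p)) (length-elements p)

∈-elements⁻ : ∀ {m} (p : Subset m) {x} → x ∈ˡ elements p → x ∈ p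
∈-elements⁻ (inside ∷ p) (here refl) = Vec.here
∈-elements⁻ (inside ∷ p) (there x∈) with ∈-map⁻ suc x∈
... | _ , y∈ , refl = Vec.there (∈-elements⁻ p y∈)
∈-elements⁻ (outside ∷ p) x∈ with ∈-map⁻ suc x∈
... | _ , y∈ , refl = Vec.there (∈-elements⁻ p y∈)

elements-unique : ∀ {m} (p : Subset m) → Unique (elements p)
elements-unique []            = []
elements-unique (inside ∷ p)  = All.map⁺ (All.tabulate λ _ ()) ∷ map⁺ suc-injective (elements-unique p)
elements-unique (outside ∷ p) = map⁺ suc-injective (elements-unique p)

module _ {G : Graph} (acyclic : Acyclic G) where

  acyclic⇒¬triangle : ∀ {p q r} → Adj G p q → Adj G q r → Adj G r p → ⊥
  acyclic⇒¬triangle {p} {q} {r} p~q q~r r~p = acyclic record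
    { first = p ; rest = q ∷ [] ; last = r ; long = s≤s (s≤s z≤n)
    ; chain    = cons p~q (cons q~r one)
    ; distinct = (Adj⇒≢ G p~q All.∷ (Adj⇒≢ G r~p ∘ sym) All.∷ All.[])
               ∷ (Adj⇒≢ G q~r All.∷ All.[]) ∷ All.[] ∷ []
    ; closing  = r~p }

  acyclic⇒¬square : ∀ {p q r s} → Adj G p q → Adj G q r → Adj G r s → Adj G s p → p ≢ r → q ≢ s → ⊥
  acyclic⇒¬square {p} {q} {r} {s} p~q q~r r~s s~p p≢r q≢s = acyclic record
    { first = p ; rest = q ∷ r ∷ [] ; last = s ; long = s≤s (s≤s z≤n)
    ; chain    = cons p~q (cons q~r (cons r~s one))
    ; distinct = (Adj⇒≢ G p~q All.∷ p≢r All.∷ (Adj⇒≢ G s~p ∘ sym) All.∷ All.[])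
               ∷ (Adj⇒≢ G q~r All.∷ q≢s All.∷ All.[]) ∷ (Adj⇒≢ G r~s All.∷ All.[]) ∷ All.[] ∷ []
    ; closing  = s~p }

  acyclic⇒near-neighbour-unique : ∀ {x d z w} → x ≢ d → Adj G x z → Adj G x w
                                → Near G d z → Near G d w → z ≡ w
  acyclic⇒near-neighbour-unique x≢d x~z x~w (inj₁ refl) (inj₁ refl) = refl
  acyclic⇒near-neighbour-unique x≢d x~z x~w (inj₁ refl) (inj₂ d~w) =
    ⊥-elim (acyclic⇒¬triangle x~z d~w (Adj-sym G x~w))
  acyclic⇒near-neighbour-unique x≢d x~z x~w (inj₂ d~z) (inj₁ refl) =
    ⊥-elim (acyclic⇒¬triangle x~w d~z (Adj-sym G x~z))
  acyclic⇒near-neighbour-unique {z = z} {w} x≢d x~z x~w (inj₂ d~z) (inj₂ d~w) with z ≟ w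
  ... | yes z≡w = z≡w
  ... | no  z≢w = ⊥-elim (acyclic⇒¬square x~z (Adj-sym G d~z) d~w (Adj-sym G x~w) x≢d z≢w)

dominator : ∀ {G D} → Dominating G D → ∀ v → ∃ λ u → u ∈ D × Near G u v
dominator dom v = Sum.[ (λ v∈D → v , v∈D , inj₁ refl) , (λ (u , u∈D , u~v) → u , u∈D , inj₂ u~v) ] (dom v)

near-unobserved⇒removed : ∀ {G S u v d} → u ∈ S → Near G u v → ¬ Observed G (S - d) v → u ≡ d
near-unobserved⇒removed {u = u} {d = d} u∈S near ¬obs =
  decidable-stable (u ≟ d) λ u≢d → ¬obs (near-observed (x∈p∧x≢y⇒x∈p-y u∈S u≢d) near)

module _ {T : Graph} (acyclic : Acyclic T) {D : Subset (n T)} (dominating : Dominating T D) where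

  Unobserved : V T → V T → Set
  Unobserved d v = ¬ Observed T (D - d) v

  Block : V T → V T → Set
  Block d v = v ≡ d ⊎ Unobserved d v

  unobserved⇒near : ∀ {d v} → Unobserved d v → Near T d v
  unobserved⇒near {v = v} ¬obs with dominator {T} dominating v
  ... | u , u∈D , near with near-unobserved⇒removed {T} u∈D near ¬obs
  ... | refl = near

  closedNbhd⊆block : ∀ {d v} → ClosedNbhd T (Unobserved d) v → Block d v
  closedNbhd⊆block (inj₁ ¬obs) = inj₂ ¬obs
  closedNbhd⊆block {d} {v} (inj₂ (x , ¬obs-x , v~x)) with v ≟ d
  ... | yes v≡d = inj₁ v≡d
  -- an observed v ≠ d would have a second neighbour in Unobserved d ⊆ N[d], closing a cycle through d
  ... | no  v≢d = inj₂ λ obs-v → unobserved-closed T ¬obs-x v~x (λ ¬obs-v → ¬obs-v obs-v)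
          λ (w , ¬obs-w , w≢x , v~w) → w≢x (sym (acyclic⇒near-neighbour-unique acyclic v≢d v~x v~w
                                                   (unobserved⇒near ¬obs-x) (unobserved⇒near ¬obs-w)))

  block-disjoint : ∀ {d d' v} → d ∈ D → d' ∈ D → Block d v → Block d' v → d ≡ d'
  block-disjoint _   _    (inj₁ refl) (inj₁ refl)  = refl
  block-disjoint d∈D _    (inj₁ refl) (inj₂ ¬obs') = near-unobserved⇒removed {T} d∈D (inj₁ refl) ¬obs'
  block-disjoint _   d'∈D (inj₂ ¬obs) (inj₁ refl)  = sym (near-unobserved⇒removed {T} d'∈D (inj₁ refl) ¬obs)
  block-disjoint {v = v} _ _ (inj₂ ¬obs) (inj₂ ¬obs') with dominator {T} dominating v
  ... | u , u∈D , near =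
    trans (sym (near-unobserved⇒removed {T} u∈D near ¬obs)) (near-unobserved⇒removed {T} u∈D near ¬obs')

  fortPacking-acyclic : (∀ S → PowerDominating T S → ∣ D ∣ ≤ ∣ S ∣) → FortPacking T ∣ D ∣
  fortPacking-acyclic minimal = record
    { Index    = V T
    ; indices  = elements D
    ; unique   = elements-unique D
    ; size     = length-elements D
    ; fort     = Unobserved
    ; isFort   = λ d∈ → unobserved-fort T (¬powerDominating (∈-elements⁻ D d∈))
    ; disjoint = λ d∈ d'∈ v∈N v∈N' → block-disjoint (∈-elements⁻ D d∈) (∈-elements⁻ D d'∈)
                                       (closedNbhd⊆block v∈N) (closedNbhd⊆block v∈N')
    }
    where
    ¬powerDominating : ∀ {d} → d ∈ D → ¬ PowerDominating T (D - d)
    ¬powerDominating d∈D pd = <⇒≱ (x∈p⇒∣p-x∣<∣p∣ d∈D) (minimal _ pd)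

theorem1p3 : (T₁ T₂ : Graph) → IsTree T₁ → IsTree T₂
    → (a b c : ℕ)
    → IsPowerDominationNumber T₁ a → IsDominationNumber T₁ a
    → IsPowerDominationNumber T₂ b → IsDominationNumber T₂ b
    → IsPowerDominationNumber (T₁ □ T₂) c
    → a * b ≤ c
theorem1p3 T₁ T₂ (_ , _ , acyclic₁) (_ , _ , acyclic₂) _ _ _
  (_ , γP₁-minimal) ((D₁ , dominating₁ , refl) , _)
  (_ , γP₂-minimal) ((D₂ , dominating₂ , refl) , _)
  ((S , powerDominating , refl) , _) =
  fortPacking⇒≤ (Product.fortPacking-□ T₁ T₂ (fortPacking-acyclic acyclic₁ dominating₁ γP₁-minimal)
                                             (fortPacking-acyclic acyclic₂ dominating₂ γP₂-minimal))
                powerDominating
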